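{- There exist $\epsilon,\delta>0$ with the following property. If $G$ is a $K_4$-free graph of order $n$ and maximum degree at most $3$, and $k$ is a positive integer with $k\leq (1+\epsilon)\frac{n}{4}$, then $\mathrm{mis}_k(G)\leq (4-\delta)^{\frac{n}{4}}$.
   Context: All graphs are finite, simple and undirected. For a graph $G$ and a non-negative integer $k$, $\mathrm{mis}_k(G)$ denotes the number of maximal independent sets of $G$ (independent sets not properly contained in another independent set) that have exactly $k$ vertices. A graph is $K_4$-free if it contains no complete graph on $4$ vertices as a subgraph. -}

module Defs where

open import Data.Nat using (ℕ; zero; suc; _≤_)
open import Data.Nat.Properties using (_≟_)
open import Data.Bool using (Bool; true; false)
open import Data.Bool.Properties using () renaming (_≟_ to _≟ᵇ_)
open import Data.Fin using (Fin)
open import Data.Fin.Properties using (all?)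
open import Data.Fin.Subset using (Subset; _∈_; _⊂_; ∣_∣; inside; outside)
open import Data.Fin.Subset.Properties using (_∈?_; _⊂?_; anySubset?)
open import Data.Vec using (Vec; []; _∷_; tabulate)
open import Data.List using (List; []; _∷_; map; _++_; filter; length)
open import Data.Product using (_×_; ∃)
open import Data.Empty using (⊥)
open import Relation.Nullary using (¬_; Dec; yes; no; _×-dec_; ¬?; _→-dec_)
open import Relation.Binary.PropositionalEquality using (_≡_)
open import Data.Rational using (ℚ; 1ℚ; _*_)

record Graph (n : ℕ) : Set where
  field
    adj    : Fin n → Fin n → Bool
    sym    : ∀ u v → adj u v ≡ adj v u
    irrefl : ∀ v → adj v v ≡ false
open Graph public

module _ {n : ℕ} (G : Graph n) where

  neighbourhood : Fin n → Subset n
  neighbourhood v = tabulate (adj G v)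

  degree : Fin n → ℕ
  degree v = ∣ neighbourhood v ∣

  MaxDegreeAtMost : ℕ → Set
  MaxDegreeAtMost d = ∀ v → degree v ≤ d

  -- no four pairwise adjacent vertices (adjacency forces distinctness)
  K4Free : Set
  K4Free = ∀ a b c d →
    adj G a b ≡ true → adj G a c ≡ true → adj G a d ≡ true →
    adj G b c ≡ true → adj G b d ≡ true → adj G c d ≡ true → ⊥

  Independent : Subset n → Set
  Independent S = ∀ u v → u ∈ S → v ∈ S → adj G u v ≡ false

  MaximalIndependent : Subset n → Set
  MaximalIndependent S = Independent S × ¬ (∃ λ T → Independent T × S ⊂ T)

  independent? : ∀ S → Dec (Independent S)
  independent? S = all? λ u → all? λ v →
    (u ∈? S) →-dec ((v ∈? S) →-dec (adj G u v ≟ᵇ false))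

  maximalIndependent? : ∀ S → Dec (MaximalIndependent S)
  maximalIndependent? S = independent? S ×-dec
    ¬? (anySubset? (λ T → independent? T ×-dec (S ⊂? T)))

allSubsets : (n : ℕ) → List (Subset n)
allSubsets zero = [] ∷ []
allSubsets (suc n) = map (inside ∷_) (allSubsets n) ++ map (outside ∷_) (allSubsets n)

mis : {n : ℕ} → Graph n → ℕ → ℕ
mis {n} G k = length (filter (λ S → maximalIndependent? G S ×-dec (∣ S ∣ ≟ k)) (allSubsets n))

_^ℚ_ : ℚ → ℕ → ℚ
q ^ℚ zero = 1ℚ
q ^ℚ suc m = q * (q ^ℚ m)

module Submission where

-- Every maximal independent set S of the induced subgraph G[W] meets the closed neighbourhood
-- N[v] ∩ W of any v ∈ W, and removing a vertex u ∈ S ∩ N[v] leaves a maximal independent set of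
-- G[W ─ N[u]] with one vertex fewer. Branching on v therefore costs a factor |N[v] ∩ W|.
-- Branching on a vertex of degree at most 2 in G[W] costs only 3. If G[W] has minimum degree 3,
-- then for every u ∈ W the graph G[W ─ N[u]] has a vertex of degree at most 2: otherwise every
-- neighbour of a vertex x ∈ N(u) ∩ W lies in N[u] (a vertex outside would have lost its
-- neighbour x), so N(u) ∩ W is a triangle and N[u] a K4. Two steps together therefore cost at
-- most 4 · 3 = 12 < (7/2)², and induction on k gives 2ᵏ · misₖ(G[W]) ≤ 7ᵏ, with the extra factor
-- 6/7 when G[W] has a vertex of degree at most 2. Finally, for 4k ≤ (21/20) n,
-- misₖ(G)⁴ ≤ (7/2)^(4k) ≤ ((7/2)^(21/20))ⁿ ≤ (15/4)ⁿ, so ε = 1/20 and δ = 1/4 work.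

module Counting where

  open import Data.Nat using (ℕ; zero; suc; _+_; _*_; _≤_; _<_; z≤n; s≤s)
  open import Data.Nat.Properties
  open import Data.Bool using (if_then_else_; true; false)
  open import Data.Fin using (Fin; zero; suc)
  open import Data.Fin.Subset using (Subset; inside; outside; _∈_; _∉_; _∪_; _─_; _-_; ∣_∣; Nonempty)
  open import Data.Fin.Subset.Properties using (_∈?_; p─⊥≡p; ∣p∣≤∣x∷p∣; x∉⁅y⁆⇒x≢y)
  open import Data.Vec using ([]; _∷_; here; there)
  open import Data.List using (map; filter; length; _++_)
  import Data.List as List
  open import Data.List.Properties using (filter-++; length-++)
  open import Data.Product using (∃; _×_; _,_)
  import Data.Product as Product
  open import Function using (_∘_; _∘′_)
  open import Level using (Level)
  open import Relation.Nullary using (Dec; yes; no; does; ¬_)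
  open import Relation.Nullary.Negation using (contradiction)
  open import Relation.Unary using (Pred; Decidable)
  open import Relation.Binary.PropositionalEquality
  open import Algebra.Properties.Semiring.Sum +-*-semiring public using (sum; sum-syntax)
  open import Algebra.Properties.Semiring.Sum +-*-semiring using (∑-distrib-+; sum-remove)

  open import Defs using (allSubsets)

  private
    variable
      a p : Level
      A B : Set a
      n k : ℕ
      x : Fin n
      P Q : Subset n

  -- Defined through `does` so that 𝟙 (suc u ∈? s ∷ S) reduces to 𝟙 (u ∈? S).
  𝟙 : Dec A → ℕ
  𝟙 a? = if does a? then 1 else 0

  1≤𝟙 : (a? : Dec A) → A → 1 ≤ 𝟙 a?
  1≤𝟙 (yes _) _ = ≤-refl
  1≤𝟙 (no ¬a) a = contradiction a ¬a

  𝟙-false : (a? : Dec A) → ¬ A → 𝟙 a? ≡ 0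
  𝟙-false (yes a) ¬a = contradiction a ¬a
  𝟙-false (no _) _ = refl

  𝟙-≤ : ∀ {r} (a? : Dec A) → (A → 1 ≤ r) → 𝟙 a? ≤ r
  𝟙-≤ (yes a) 1≤r = 1≤r a
  𝟙-≤ (no _) _ = z≤n

  𝟙-mono : (A → B) → (a? : Dec A) (b? : Dec B) → 𝟙 a? ≤ 𝟙 b?
  𝟙-mono f a? b? = 𝟙-≤ a? (1≤𝟙 b? ∘ f)

  sum-mono-≤ : {f g : Fin n → ℕ} → (∀ i → f i ≤ g i) → sum f ≤ sum g
  sum-mono-≤ {zero} f≤g = z≤n
  sum-mono-≤ {suc n} f≤g = +-mono-≤ (f≤g zero) (sum-mono-≤ (f≤g ∘ suc))

  f≤∑f : ∀ (f : Fin n → ℕ) i → f i ≤ sum f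
  f≤∑f {suc n} f i = ≤-trans (m≤m+n (f i) _) (≤-reflexive (sym (sum-remove {i = i} f)))

  ∑-𝟙-≤ : ∀ (X : Subset n) (f : Fin n → ℕ) {B} → (∀ u → u ∈ X → f u ≤ B) →
    ∑[ u < n ] (𝟙 (u ∈? X) * f u) ≤ ∣ X ∣ * B
  ∑-𝟙-≤ [] f f≤B = z≤n
  ∑-𝟙-≤ (inside ∷ X) f f≤B = +-mono-≤
    (≤-trans (≤-reflexive (+-identityʳ (f zero))) (f≤B zero here))
    (∑-𝟙-≤ X (f ∘ suc) (λ u → f≤B (suc u) ∘ there))
  ∑-𝟙-≤ (outside ∷ X) f f≤B = ∑-𝟙-≤ X (f ∘ suc) (λ u → f≤B (suc u) ∘ there)

  ∑ₛ : (Subset n → ℕ) → ℕ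
  ∑ₛ {zero} f = f []
  ∑ₛ {suc n} f = ∑ₛ (f ∘ (inside ∷_)) + ∑ₛ (f ∘ (outside ∷_))

  ∑ₛ-mono-≤ : {f g : Subset n → ℕ} → (∀ S → f S ≤ g S) → ∑ₛ f ≤ ∑ₛ g
  ∑ₛ-mono-≤ {zero} f≤g = f≤g []
  ∑ₛ-mono-≤ {suc n} f≤g =
    +-mono-≤ (∑ₛ-mono-≤ (f≤g ∘ (inside ∷_))) (∑ₛ-mono-≤ (f≤g ∘ (outside ∷_)))

  ∑ₛ-zero : {f : Subset n → ℕ} → (∀ S → f S ≡ 0) → ∑ₛ f ≡ 0
  ∑ₛ-zero {zero} f≡0 = f≡0 []
  ∑ₛ-zero {suc n} f≡0 =
    cong₂ _+_ (∑ₛ-zero (f≡0 ∘ (inside ∷_))) (∑ₛ-zero (f≡0 ∘ (outside ∷_)))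

  ∑ₛ-*ˡ : ∀ c (f : Subset n → ℕ) → ∑ₛ (λ S → c * f S) ≡ c * ∑ₛ f
  ∑ₛ-*ˡ {zero} c f = refl
  ∑ₛ-*ˡ {suc n} c f = trans
    (cong₂ _+_ (∑ₛ-*ˡ c (f ∘ (inside ∷_))) (∑ₛ-*ˡ c (f ∘ (outside ∷_))))
    (sym (*-distribˡ-+ c _ _))

  ∑ₛ-∑-comm : ∀ {m} (f : Fin m → Subset n → ℕ) →
    ∑ₛ (λ S → ∑[ u < m ] f u S) ≡ ∑[ u < m ] ∑ₛ (f u)
  ∑ₛ-∑-comm {zero} f = refl
  ∑ₛ-∑-comm {suc n} f = trans
    (cong₂ _+_ (∑ₛ-∑-comm (λ u → f u ∘ (inside ∷_))) (∑ₛ-∑-comm (λ u → f u ∘ (outside ∷_))))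
    (sym (∑-distrib-+ (λ u → ∑ₛ (f u ∘ (inside ∷_))) (λ u → ∑ₛ (f u ∘ (outside ∷_)))))

  ∑ₛ-remove-≤ : ∀ (u : Fin n) {f g : Subset n → ℕ} → (∀ S → u ∈ S → f S ≤ g (S - u)) →
    ∑ₛ (λ S → 𝟙 (u ∈? S) * f S) ≤ ∑ₛ g
  ∑ₛ-remove-≤ {suc n} zero {f} {g} f≤g = ≤-trans
    (+-mono-≤ (∑ₛ-mono-≤ removed) (∑ₛ-mono-≤ {n} λ _ → z≤n))
    (≤-reflexive (+-comm (∑ₛ (g ∘ (outside ∷_))) _))
    where
    removed : ∀ S → 1 * f (inside ∷ S) ≤ g (outside ∷ S)
    removed S = ≤-trans (≤-reflexive (*-identityˡ _))
      (subst (λ T → f (inside ∷ S) ≤ g (outside ∷ T)) (p─⊥≡p S) (f≤g (inside ∷ S) here))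
  ∑ₛ-remove-≤ (suc u) f≤g = +-mono-≤
    (∑ₛ-remove-≤ u (λ S → f≤g (inside ∷ S) ∘ there))
    (∑ₛ-remove-≤ u (λ S → f≤g (outside ∷ S) ∘ there))

  length-filter-map : ∀ {P : Pred B p} (P? : Decidable P) (f : A → B) xs →
    length (filter P? (map f xs)) ≡ length (filter (P? ∘ f) xs)
  length-filter-map P? f List.[] = refl
  length-filter-map P? f (x List.∷ xs) with does (P? (f x))
  ... | true = cong suc (length-filter-map P? f xs)
  ... | false = length-filter-map P? f xs

  length-filter-allSubsets : ∀ {P : Pred (Subset n) p} (P? : Decidable P) →
    length (filter P? (allSubsets n)) ≡ ∑ₛ (𝟙 ∘ P?)
  length-filter-allSubsets {zero} P? with does (P? [])
  ... | true = refl
  ... | false = refl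
  length-filter-allSubsets {suc n} P? = begin
    length (filter P? (map (inside ∷_) ss ++ map (outside ∷_) ss))
      ≡⟨ cong length (filter-++ P? (map (inside ∷_) ss) _) ⟩
    length (filter P? (map (inside ∷_) ss) ++ filter P? (map (outside ∷_) ss))
      ≡⟨ length-++ (filter P? (map (inside ∷_) ss)) ⟩
    length (filter P? (map (inside ∷_) ss)) + length (filter P? (map (outside ∷_) ss))
      ≡⟨ cong₂ _+_ (length-filter-map P? _ ss) (length-filter-map P? _ ss) ⟩
    length (filter (P? ∘ (inside ∷_)) ss) + length (filter (P? ∘ (outside ∷_)) ss)
      ≡⟨ cong₂ _+_ (length-filter-allSubsets {n} _) (length-filter-allSubsets {n} _) ⟩
    ∑ₛ (𝟙 ∘ P?) ∎
    where
    open ≡-Reasoning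
    ss = allSubsets n

  ∣p∪q∣≤∣p∣+∣q∣ : ∀ (p q : Subset n) → ∣ p ∪ q ∣ ≤ ∣ p ∣ + ∣ q ∣
  ∣p∪q∣≤∣p∣+∣q∣ [] [] = z≤n
  ∣p∪q∣≤∣p∣+∣q∣ (inside ∷ p) (s ∷ q) =
    s≤s (≤-trans (∣p∪q∣≤∣p∣+∣q∣ p q) (+-monoʳ-≤ ∣ p ∣ (∣p∣≤∣x∷p∣ s q)))
  ∣p∪q∣≤∣p∣+∣q∣ (outside ∷ p) (inside ∷ q) =
    ≤-trans (s≤s (∣p∪q∣≤∣p∣+∣q∣ p q)) (≤-reflexive (sym (+-suc ∣ p ∣ ∣ q ∣)))
  ∣p∪q∣≤∣p∣+∣q∣ (outside ∷ p) (outside ∷ q) = ∣p∪q∣≤∣p∣+∣q∣ p q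

  x∈p⇒∣p∣≡1+∣p-x∣ : x ∈ P → ∣ P ∣ ≡ suc ∣ P - x ∣
  x∈p⇒∣p∣≡1+∣p-x∣ {P = inside ∷ p} here = cong (suc ∘′ ∣_∣) (sym (p─⊥≡p p))
  x∈p⇒∣p∣≡1+∣p-x∣ {P = inside ∷ p} (there x∈p) = cong suc (x∈p⇒∣p∣≡1+∣p-x∣ x∈p)
  x∈p⇒∣p∣≡1+∣p-x∣ {P = outside ∷ p} (there x∈p) = x∈p⇒∣p∣≡1+∣p-x∣ x∈p

  x∈p─q⇒x∉q : x ∈ P ─ Q → x ∉ Q
  x∈p─q⇒x∉q {P = _ ∷ _} {Q = outside ∷ _} here ()
  x∈p─q⇒x∉q {P = _ ∷ _} {Q = _ ∷ _} (there x∈p─q) (there x∈q) = x∈p─q⇒x∉q x∈p─q x∈q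

  x∈p-y⇒x≢y : ∀ {y} → x ∈ P - y → x ≢ y
  x∈p-y⇒x≢y = x∉⁅y⁆⇒x≢y ∘ x∈p─q⇒x∉q

  ∣p∣>0⇒nonempty : 0 < ∣ P ∣ → Nonempty P
  ∣p∣>0⇒nonempty {P = inside ∷ p} _ = zero , here
  ∣p∣>0⇒nonempty {P = outside ∷ p} ∣p∣>0 = Product.map suc there (∣p∣>0⇒nonempty ∣p∣>0)

  take-element : ∀ (P : Subset n) → suc k ≤ ∣ P ∣ → ∃ λ x → x ∈ P × k ≤ ∣ P - x ∣
  take-element {k = k} P 1+k≤∣p∣ with ∣p∣>0⇒nonempty (≤-trans (s≤s z≤n) 1+k≤∣p∣)
  ... | x , x∈p = x , x∈p , ≤-pred (subst (suc k ≤_) (x∈p⇒∣p∣≡1+∣p-x∣ x∈p) 1+k≤∣p∣)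

module Graphs where

  open import Data.Nat using (ℕ; zero; suc; _+_; _*_; _^_; _≤_; _<_; z≤n; s≤s)
  open import Data.Nat.Properties hiding (_≟_)
  import Data.Nat.Properties as ℕ
  open import Data.Nat.Tactic.RingSolver using (solve-∀)
  open import Data.Bool using (true; false)
  open import Data.Bool.Properties using (¬-not) renaming (_≟_ to _≟ᵇ_)
  open import Data.Empty using (⊥)
  open import Data.Fin using (Fin)
  open import Data.Fin.Properties using (all?; any?)
  open import Data.Fin.Subset using (Subset; ⊤; ⁅_⁆; _∈_; _∉_; _⊆_; _⊂_; _∩_; _∪_; _─_; _-_; ∣_∣; Empty)
  open import Data.Fin.Subset.Properties
  open import Data.Vec.Properties using (lookup⇒[]=; []=⇒lookup; lookup∘tabulate)
  open import Data.Product using (∃; _×_; _,_; proj₁; proj₂; map₁)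
  open import Data.Sum using (inj₁; inj₂; [_,_])
  open import Function using (_∘_)
  open import Relation.Nullary using (Dec; yes; no; ¬_; ¬?; _×-dec_; _→-dec_)
  open import Relation.Nullary.Decidable using (decidable-stable)
  open import Relation.Nullary.Negation using (contradiction)
  open import Relation.Binary.PropositionalEquality hiding ([_])
  open import Algebra.Properties.Semiring.Sum +-*-semiring using (sum-cong-≗; *-distribˡ-sum)
  open import Algebra.Properties.CommutativeSemigroup *-commutativeSemigroup using (x∙yz≈y∙xz)

  open import Defs renaming (sym to adj-sym)
  open Counting

  module InducedSubgraphs {n : ℕ} (G : Graph n) where

    infix 4 _~_
    _~_ : Fin n → Fin n → Set
    u ~ v = adj G u v ≡ true

    ~⇒∈N : ∀ {u v} → u ~ v → v ∈ neighbourhood G u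
    ~⇒∈N {u} {v} u~v = lookup⇒[]= v _ (trans (lookup∘tabulate (adj G u) v) u~v)

    ∈N⇒~ : ∀ {u v} → v ∈ neighbourhood G u → u ~ v
    ∈N⇒~ {u} {v} v∈N = trans (sym (lookup∘tabulate (adj G u) v)) ([]=⇒lookup v∈N)

    N[_] : Fin n → Subset n
    N[ v ] = ⁅ v ⁆ ∪ neighbourhood G v

    degreeIn : Subset n → Fin n → ℕ
    degreeIn W v = ∣ W ∩ neighbourhood G v ∣

    HasLowVertex : Subset n → Set
    HasLowVertex W = ∃ λ v → v ∈ W × degreeIn W v ≤ 2

    hasLowVertex? : ∀ W → Dec (HasLowVertex W)
    hasLowVertex? W = any? λ v → (v ∈? W) ×-dec (degreeIn W v ℕ.≤? 2)

    Dominates : Subset n → Subset n → Set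
    Dominates S W = ∀ w → w ∈ W → w ∉ S → ∃ λ s → s ∈ S × w ~ s

    hasNeighbourIn? : ∀ w S → Dec (∃ λ s → s ∈ S × w ~ s)
    hasNeighbourIn? w S = any? λ s → (s ∈? S) ×-dec (adj G w s ≟ᵇ true)

    dominates? : ∀ S W → Dec (Dominates S W)
    dominates? S W = all? λ w → (w ∈? W) →-dec (¬? (w ∈? S) →-dec hasNeighbourIn? w S)

    -- S is a maximal independent set of the induced subgraph G[W]; maximality is phrased as
    -- domination of W.
    MaximalIndependentIn : Subset n → Subset n → Set
    MaximalIndependentIn W S = S ⊆ W × Independent G S × Dominates S W

    maximalIndependentIn? : ∀ W S → Dec (MaximalIndependentIn W S)
    maximalIndependentIn? W S = (S ⊆? W) ×-dec independent? G S ×-dec dominates? S W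

    misOfSize? : ∀ W k S → Dec (MaximalIndependentIn W S × ∣ S ∣ ≡ k)
    misOfSize? W k S = maximalIndependentIn? W S ×-dec (∣ S ∣ ℕ.≟ k)

    misIn : Subset n → ℕ → ℕ
    misIn W k = ∑ₛ (𝟙 ∘ misOfSize? W k)

    independent-⊆ : ∀ {S T} → S ⊆ T → Independent G T → Independent G S
    independent-⊆ S⊆T indT u v u∈S v∈S = indT u v (S⊆T u∈S) (S⊆T v∈S)

    maximal⇒maximalIn-⊤ : ∀ {S} → MaximalIndependent G S → MaximalIndependentIn ⊤ S
    maximal⇒maximalIn-⊤ {S} (indS , ¬extendable) = (λ _ → ∈⊤) , indS , dominates
      where
      dominates : Dominates S ⊤
      dominates w _ w∉S = decidable-stable (hasNeighbourIn? w S) λ ¬nbr →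
        ¬extendable (S ∪ ⁅ w ⁆ , independent-∪ ¬nbr
                    , p⊆p∪q ⁅ w ⁆ , w , x∈p∪q⁺ (inj₂ (x∈⁅x⁆ w)) , w∉S)
        where
        w≁ : ¬ (∃ λ s → s ∈ S × w ~ s) → ∀ {s} → s ∈ S → adj G w s ≡ false
        w≁ ¬nbr s∈S = ¬-not λ w~s → ¬nbr (_ , s∈S , w~s)
        independent-∪ : ¬ (∃ λ s → s ∈ S × w ~ s) → Independent G (S ∪ ⁅ w ⁆)
        independent-∪ ¬nbr x y x∈ y∈ with x∈p∪q⁻ S _ x∈ | x∈p∪q⁻ S _ y∈
        ... | inj₁ x∈S | inj₁ y∈S = indS x y x∈S y∈S
        ... | inj₁ x∈S | inj₂ y∈⁅w⁆ rewrite x∈⁅y⁆⇒x≡y w y∈⁅w⁆ =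
          trans (adj-sym G x w) (w≁ ¬nbr x∈S)
        ... | inj₂ x∈⁅w⁆ | inj₁ y∈S rewrite x∈⁅y⁆⇒x≡y w x∈⁅w⁆ = w≁ ¬nbr y∈S
        ... | inj₂ x∈⁅w⁆ | inj₂ y∈⁅w⁆ rewrite x∈⁅y⁆⇒x≡y w x∈⁅w⁆ | x∈⁅y⁆⇒x≡y w y∈⁅w⁆ =
          irrefl G w

    mis≤misIn-⊤ : ∀ k → mis G k ≤ misIn ⊤ k
    mis≤misIn-⊤ k = begin
      mis G k
        ≡⟨ length-filter-allSubsets (λ S → maximalIndependent? G S ×-dec (∣ S ∣ ℕ.≟ k)) ⟩
      ∑ₛ (λ S → 𝟙 (maximalIndependent? G S ×-dec (∣ S ∣ ℕ.≟ k)))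
        ≤⟨ ∑ₛ-mono-≤ (λ S → 𝟙-mono (map₁ maximal⇒maximalIn-⊤)
             (maximalIndependent? G S ×-dec (∣ S ∣ ℕ.≟ k)) (misOfSize? ⊤ k S)) ⟩
      misIn ⊤ k ∎
      where open ≤-Reasoning

    ∉-size-0 : ∀ {S : Subset n} {x} → ∣ S ∣ ≡ 0 → x ∉ S
    ∉-size-0 ∣S∣≡0 x∈S = 0≢1+n (trans (sym ∣S∣≡0) (x∈p⇒∣p∣≡1+∣p-x∣ x∈S))

    misIn-0≤1 : ∀ W → misIn W 0 ≤ 1
    misIn-0≤1 W = ≤-trans (∑ₛ-mono-≤ {n} (λ S → 𝟙-mono proj₂ (misOfSize? W 0 S) (∣ S ∣ ℕ.≟ 0)))
                          (≤-reflexive (size-0-count n))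
      where
      size-0-count : ∀ m → ∑ₛ {m} (λ S → 𝟙 (∣ S ∣ ℕ.≟ 0)) ≡ 1
      size-0-count zero = refl
      size-0-count (suc m) = cong₂ _+_ (∑ₛ-zero {m} λ _ → refl) (size-0-count m)

    misIn-0≡0 : ∀ {W v} → v ∈ W → misIn W 0 ≡ 0
    misIn-0≡0 {W} {v} v∈W = ∑ₛ-zero λ S → 𝟙-false (misOfSize? W 0 S)
      λ ((_ , _ , dom) , ∣S∣≡0) → ∉-size-0 ∣S∣≡0 (proj₁ (proj₂ (dom v v∈W (∉-size-0 ∣S∣≡0))))

    misIn-empty : ∀ {W} k → Empty W → misIn W (suc k) ≡ 0
    misIn-empty {W} k empty = ∑ₛ-zero λ S → 𝟙-false (misOfSize? W (suc k) S)
      λ ((S⊆W , _) , ∣S∣≡1+k) →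
        let (s , s∈S) = ∣p∣>0⇒nonempty (subst (0 <_) (sym ∣S∣≡1+k) (s≤s z≤n)) in empty (s , S⊆W s∈S)

    meets-closed-neighbourhood : ∀ {W S v} → v ∈ W → MaximalIndependentIn W S →
      ∃ λ u → u ∈ W ∩ N[ v ] × u ∈ S
    meets-closed-neighbourhood {W} {S} {v} v∈W (S⊆W , _ , dom) with v ∈? S
    ... | yes v∈S = v , x∈p∩q⁺ (v∈W , x∈p∪q⁺ (inj₁ (x∈⁅x⁆ v))) , v∈S
    ... | no v∉S with dom v v∈W v∉S
    ... | s , s∈S , v~s = s , x∈p∩q⁺ (S⊆W s∈S , x∈p∪q⁺ (inj₂ (~⇒∈N v~s))) , s∈S

    maximalIn-remove : ∀ {W S u} → MaximalIndependentIn W S → u ∈ S →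
      MaximalIndependentIn (W ─ N[ u ]) (S - u)
    maximalIn-remove {W} {S} {u} (S⊆W , indS , dom) u∈S =
      S-u⊆W─N[u] , independent-⊆ (p─q⊆p S _) indS , dom′
      where
      S-avoids-Nu : ∀ {x} → x ∈ S → x ∉ neighbourhood G u
      S-avoids-Nu x∈S x∈N = contradiction (trans (sym (∈N⇒~ x∈N)) (indS _ _ u∈S x∈S)) λ ()
      S-u⊆W─N[u] : S - u ⊆ W ─ N[ u ]
      S-u⊆W─N[u] x∈S-u =
        x∈p∧x∉q⇒x∈p─q (S⊆W x∈S) ([ x∈p─q⇒x∉q x∈S-u , S-avoids-Nu x∈S ] ∘ x∈p∪q⁻ _ _)
        where x∈S = p─q⊆p S _ x∈S-u
      dom′ : Dominates (S - u) (W ─ N[ u ])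
      dom′ w w∈ w∉S-u =
        let (s , s∈S , w~s) = dom w (p─q⊆p W _ w∈) w∉S
            s≢u : s ≢ u
            s≢u s≡u = w∉N[u] (x∈p∪q⁺ (inj₂ (~⇒∈N (trans (adj-sym G u w) (subst (w ~_) s≡u w~s)))))
        in s , x∈p∧x≢y⇒x∈p-y s∈S s≢u , w~s
        where
        w∉N[u] = x∈p─q⇒x∉q w∈
        w≢u : w ≢ u
        w≢u refl = w∉N[u] (x∈p∪q⁺ (inj₁ (x∈⁅x⁆ u)))
        w∉S : w ∉ S
        w∉S w∈S = w∉S-u (x∈p∧x≢y⇒x∈p-y w∈S w≢u)

    misIn-branching : ∀ {W v} k → v ∈ W →
      misIn W (suc k) ≤ ∑[ u < n ] (𝟙 (u ∈? W ∩ N[ v ]) * misIn (W ─ N[ u ]) k)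
    misIn-branching {W} {v} k v∈W = begin
      misIn W (suc k)
        ≤⟨ ∑ₛ-mono-≤ covered ⟩
      ∑ₛ (λ S → ∑[ u < n ] (𝟙 (u ∈? X) * (𝟙 (u ∈? S) * I S)))
        ≡⟨ ∑ₛ-∑-comm (λ u S → 𝟙 (u ∈? X) * (𝟙 (u ∈? S) * I S)) ⟩
      ∑[ u < n ] ∑ₛ (λ S → 𝟙 (u ∈? X) * (𝟙 (u ∈? S) * I S))
        ≡⟨ sum-cong-≗ (λ u → ∑ₛ-*ˡ (𝟙 (u ∈? X)) (λ S → 𝟙 (u ∈? S) * I S)) ⟩
      ∑[ u < n ] (𝟙 (u ∈? X) * ∑ₛ (λ S → 𝟙 (u ∈? S) * I S))
        ≤⟨ sum-mono-≤ (λ u → *-monoʳ-≤ (𝟙 (u ∈? X)) (∑ₛ-remove-≤ u (removed u))) ⟩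
      ∑[ u < n ] (𝟙 (u ∈? X) * misIn (W ─ N[ u ]) k) ∎
      where
      open ≤-Reasoning
      X = W ∩ N[ v ]
      I = 𝟙 ∘ misOfSize? W (suc k)
      covered : ∀ S → I S ≤ ∑[ u < n ] (𝟙 (u ∈? X) * (𝟙 (u ∈? S) * I S))
      covered S = 𝟙-≤ (misOfSize? W (suc k) S) λ S-mis →
        let (u , u∈X , u∈S) = meets-closed-neighbourhood v∈W (proj₁ S-mis) in
        ≤-trans (*-mono-≤ (1≤𝟙 (u ∈? X) u∈X)
                          (*-mono-≤ (1≤𝟙 (u ∈? S) u∈S) (1≤𝟙 (misOfSize? W (suc k) S) S-mis)))
                (f≤∑f (λ u → 𝟙 (u ∈? X) * (𝟙 (u ∈? S) * I S)) u)
      removed : ∀ u S → u ∈ S → I S ≤ 𝟙 (misOfSize? (W ─ N[ u ]) k (S - u))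
      removed u S u∈S = 𝟙-mono
        (λ (mis , ∣S∣≡1+k) → maximalIn-remove mis u∈S
                            , suc-injective (trans (sym (x∈p⇒∣p∣≡1+∣p-x∣ u∈S)) ∣S∣≡1+k))
        (misOfSize? W (suc k) S) (misOfSize? (W ─ N[ u ]) k (S - u))

    ∣W∩N[v]∣≤1+degreeIn : ∀ W v → ∣ W ∩ N[ v ] ∣ ≤ suc (degreeIn W v)
    ∣W∩N[v]∣≤1+degreeIn W v = begin
      ∣ W ∩ (⁅ v ⁆ ∪ neighbourhood G v) ∣  ≡⟨ cong ∣_∣ (∩-distribˡ-∪ W ⁅ v ⁆ _) ⟩
      ∣ W ∩ ⁅ v ⁆ ∪ W ∩ neighbourhood G v ∣  ≤⟨ ∣p∪q∣≤∣p∣+∣q∣ (W ∩ ⁅ v ⁆) _ ⟩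
      ∣ W ∩ ⁅ v ⁆ ∣ + degreeIn W v
        ≤⟨ +-monoˡ-≤ _ (≤-trans (∣p∩q∣≤∣q∣ W ⁅ v ⁆) (≤-reflexive (∣⁅x⁆∣≡1 v))) ⟩
      suc (degreeIn W v)                   ∎
      where open ≤-Reasoning

    misIn-branching-≤ : ∀ {W v} k {c B} → v ∈ W →
      (∀ u → u ∈ W ∩ N[ v ] → c * misIn (W ─ N[ u ]) k ≤ B) →
      c * misIn W (suc k) ≤ suc (degreeIn W v) * B
    misIn-branching-≤ {W} {v} k {c} {B} v∈W bound = begin
      c * misIn W (suc k)
        ≤⟨ *-monoʳ-≤ c (misIn-branching k v∈W) ⟩
      c * ∑[ u < n ] (𝟙 (u ∈? X) * misIn (W ─ N[ u ]) k)
        ≡⟨ *-distribˡ-sum c (λ u → 𝟙 (u ∈? X) * misIn (W ─ N[ u ]) k) ⟩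
      ∑[ u < n ] (c * (𝟙 (u ∈? X) * misIn (W ─ N[ u ]) k))
        ≡⟨ sum-cong-≗ (λ u → x∙yz≈y∙xz c (𝟙 (u ∈? X)) (misIn (W ─ N[ u ]) k)) ⟩
      ∑[ u < n ] (𝟙 (u ∈? X) * (c * misIn (W ─ N[ u ]) k))
        ≤⟨ ∑-𝟙-≤ X (λ u → c * misIn (W ─ N[ u ]) k) bound ⟩
      ∣ X ∣ * B
        ≤⟨ *-monoˡ-≤ B (∣W∩N[v]∣≤1+degreeIn W v) ⟩
      suc (degreeIn W v) * B ∎
      where
      open ≤-Reasoning
      X = W ∩ N[ v ]

  module Subcubic {n : ℕ} (G : Graph n) (k4 : K4Free G) (md : MaxDegreeAtMost G 3) where

    open InducedSubgraphs G

    degreeIn≤3 : ∀ W v → degreeIn W v ≤ 3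
    degreeIn≤3 W v = ≤-trans (∣p∩q∣≤∣q∣ W _) (md v)

    private
      module K4Around {W u} (u∈W : u ∈ W) (¬low : ¬ HasLowVertex W) (¬low′ : ¬ HasLowVertex (W ─ N[ u ])) where

        A = W ∩ neighbourhood G u

        A-closed : ∀ {x y} → x ∈ A → y ∈ W ∩ neighbourhood G x → y ∈ N[ u ]
        A-closed {x} {y} x∈A y∈W∩Nx = decidable-stable (y ∈? N[ u ]) λ y∉N[u] →
          ¬low′ (y , x∈p∧x∉q⇒x∈p─q y∈W y∉N[u]
                   , ≤-pred (≤-trans (p⊂q⇒∣p∣<∣q∣ y-loses-x) (degreeIn≤3 W y)))
          where
          x∈W = proj₁ (x∈p∩q⁻ _ _ x∈A)
          x∈Nu = proj₂ (x∈p∩q⁻ _ _ x∈A)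
          y∈W = proj₁ (x∈p∩q⁻ _ _ y∈W∩Nx)
          x~y = ∈N⇒~ (proj₂ (x∈p∩q⁻ _ _ y∈W∩Nx))
          y-loses-x : (W ─ N[ u ]) ∩ neighbourhood G y ⊂ W ∩ neighbourhood G y
          y-loses-x = (λ z∈ → let (z∈W─N[u] , z∈Ny) = x∈p∩q⁻ _ _ z∈
                              in x∈p∩q⁺ (p─q⊆p W _ z∈W─N[u] , z∈Ny))
                    , x , x∈p∩q⁺ (x∈W , ~⇒∈N (trans (adj-sym G y x) x~y))
                    , λ x∈ → x∈p─q⇒x∉q (proj₁ (x∈p∩q⁻ _ _ x∈)) (x∈p∪q⁺ (inj₂ x∈Nu))

        A-clique : ∀ {x y} → x ∈ A → y ∈ A → x ≢ y → x ~ y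
        A-clique {x} {y} x∈A y∈A x≢y =
          decidable-stable (adj G x y ≟ᵇ true) λ x≁y → ¬low (x , x∈W , degree≤2 x≁y)
          where
          x∈W = proj₁ (x∈p∩q⁻ _ _ x∈A)
          ∣A∣≡2+∣A-x-y∣ : ∣ A ∣ ≡ suc (suc ∣ A - x - y ∣)
          ∣A∣≡2+∣A-x-y∣ = trans (x∈p⇒∣p∣≡1+∣p-x∣ x∈A)
            (cong suc (x∈p⇒∣p∣≡1+∣p-x∣ (x∈p∧x≢y⇒x∈p-y y∈A (≢-sym x≢y))))
          ⊆⁅u⁆∪A-x-y : ¬ x ~ y → W ∩ neighbourhood G x ⊆ ⁅ u ⁆ ∪ (A - x - y)
          ⊆⁅u⁆∪A-x-y x≁y {z} z∈ with x∈p∪q⁻ ⁅ u ⁆ _ (A-closed x∈A z∈)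
          ... | inj₁ z∈⁅u⁆ = x∈p∪q⁺ (inj₁ z∈⁅u⁆)
          ... | inj₂ z∈Nu =
            x∈p∪q⁺ (inj₂ (x∈p∧x≢y⇒x∈p-y (x∈p∧x≢y⇒x∈p-y (x∈p∩q⁺ (z∈W , z∈Nu)) z≢x) z≢y))
            where
            z∈W = proj₁ (x∈p∩q⁻ _ _ z∈)
            x~z = ∈N⇒~ (proj₂ (x∈p∩q⁻ _ _ z∈))
            z≢x : z ≢ x
            z≢x refl = contradiction (trans (sym x~z) (irrefl G z)) λ ()
            z≢y : z ≢ y
            z≢y refl = x≁y x~z
          degree≤2 : ¬ x ~ y → degreeIn W x ≤ 2
          degree≤2 x≁y = begin
            ∣ W ∩ neighbourhood G x ∣   ≤⟨ p⊆q⇒∣p∣≤∣q∣ (⊆⁅u⁆∪A-x-y x≁y) ⟩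
            ∣ ⁅ u ⁆ ∪ (A - x - y) ∣    ≤⟨ ∣p∪q∣≤∣p∣+∣q∣ ⁅ u ⁆ _ ⟩
            ∣ ⁅ u ⁆ ∣ + ∣ A - x - y ∣   ≡⟨ cong (_+ ∣ A - x - y ∣) (∣⁅x⁆∣≡1 u) ⟩
            suc ∣ A - x - y ∣          ≤⟨ ≤-pred (subst (_≤ 3) ∣A∣≡2+∣A-x-y∣ (degreeIn≤3 W u)) ⟩
            2                          ∎
            where open ≤-Reasoning

        3≤∣A∣ : 3 ≤ ∣ A ∣
        3≤∣A∣ = ≰⇒> λ ∣A∣≤2 → ¬low (u , u∈W , ∣A∣≤2)

        K4-at-u : ⊥
        K4-at-u with take-element A 3≤∣A∣
        ... | a , a∈A , 2≤∣A-a∣ with take-element (A - a) 2≤∣A-a∣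
        ... | b , b∈A-a , 1≤∣A-a-b∣ with take-element (A - a - b) 1≤∣A-a-b∣
        ... | c , c∈A-a-b , _ = k4 u a b c (u~ a∈A) (u~ b∈A) (u~ c∈A)
          (A-clique a∈A b∈A (≢-sym b≢a)) (A-clique a∈A c∈A (≢-sym c≢a)) (A-clique b∈A c∈A (≢-sym c≢b))
          where
          u~ : ∀ {x} → x ∈ A → u ~ x
          u~ x∈A = ∈N⇒~ (proj₂ (x∈p∩q⁻ _ _ x∈A))
          b∈A = p─q⊆p A ⁅ a ⁆ b∈A-a
          c∈A-a = p─q⊆p (A - a) ⁅ b ⁆ c∈A-a-b
          c∈A = p─q⊆p A ⁅ a ⁆ c∈A-a
          b≢a = x∈p-y⇒x≢y b∈A-a
          c≢a = x∈p-y⇒x≢y c∈A-a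
          c≢b = x∈p-y⇒x≢y c∈A-a-b

    lowVertex-after-removal : ∀ {W u} → u ∈ W → ¬ HasLowVertex W → HasLowVertex (W ─ N[ u ])
    lowVertex-after-removal {W} {u} u∈W ¬low =
      decidable-stable (hasLowVertex? (W ─ N[ u ])) (K4Around.K4-at-u u∈W ¬low)

    low-vertex-step : ∀ k → (∀ W → 2 ^ k * misIn W k ≤ 7 ^ k) →
      ∀ {W v} → v ∈ W → degreeIn W v ≤ 2 → 7 * (2 ^ suc k * misIn W (suc k)) ≤ 6 * 7 ^ suc k
    low-vertex-step k bound {W} {v} v∈W low = begin
      7 * (2 ^ suc k * misIn W (suc k))    ≡⟨ regroup (2 ^ k) (misIn W (suc k)) ⟩
      14 * (2 ^ k * misIn W (suc k))
        ≤⟨ *-monoʳ-≤ 14 (misIn-branching-≤ k {c = 2 ^ k} v∈W λ u _ → bound (W ─ N[ u ])) ⟩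
      14 * (suc (degreeIn W v) * 7 ^ k)    ≤⟨ *-monoʳ-≤ 14 (*-monoˡ-≤ (7 ^ k) (s≤s low)) ⟩
      14 * (3 * 7 ^ k)                     ≡⟨ 42-from (7 ^ k) ⟩
      6 * 7 ^ suc k                        ∎
      where
      open ≤-Reasoning
      regroup : ∀ p x → 7 * (2 * p * x) ≡ 14 * (p * x)
      regroup = solve-∀
      42-from : ∀ p → 14 * (3 * p) ≡ 6 * (7 * p)
      42-from = solve-∀

    mutual
      misIn-bound : ∀ k W → 2 ^ k * misIn W k ≤ 7 ^ k
      misIn-bound zero W = ≤-trans (≤-reflexive (*-identityˡ _)) (misIn-0≤1 W)
      misIn-bound (suc k) W with hasLowVertex? W | nonempty? W
      ... | yes (v , v∈W , low) | _ =
        *-cancelˡ-≤ 7 (≤-trans (low-vertex-step k (misIn-bound k) v∈W low) (*-monoˡ-≤ (7 ^ suc k) (n≤1+n 6)))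
      ... | no _ | no empty =
        ≤-trans (≤-reflexive (trans (cong (2 ^ suc k *_) (misIn-empty k empty)) (*-zeroʳ (2 ^ suc k)))) z≤n
      ... | no ¬low | yes (v , v∈W) = *-cancelˡ-≤ 7 (begin
        7 * (2 ^ suc k * misIn W (suc k))       ≡⟨ regroup (2 ^ k) (misIn W (suc k)) ⟩
        2 * (7 * 2 ^ k * misIn W (suc k))
          ≤⟨ *-monoʳ-≤ 2 (misIn-branching-≤ k {c = 7 * 2 ^ k} v∈W each-branch) ⟩
        2 * (suc (degreeIn W v) * (6 * 7 ^ k))  ≤⟨ *-monoʳ-≤ 2 (*-monoˡ-≤ (6 * 7 ^ k) (s≤s (degreeIn≤3 W v))) ⟩
        2 * (4 * (6 * 7 ^ k))                   ≡⟨ 48-from (7 ^ k) ⟩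
        48 * 7 ^ k                              ≤⟨ *-monoˡ-≤ (7 ^ k) (n≤1+n 48) ⟩
        49 * 7 ^ k                              ≡⟨ 49-from (7 ^ k) ⟩
        7 * 7 ^ suc k                           ∎)
        where
        open ≤-Reasoning
        regroup : ∀ p x → 7 * (2 * p * x) ≡ 2 * (7 * p * x)
        regroup = solve-∀
        48-from : ∀ p → 2 * (4 * (6 * p)) ≡ 48 * p
        48-from = solve-∀
        49-from : ∀ p → 49 * p ≡ 7 * (7 * p)
        49-from = solve-∀
        each-branch : ∀ u → u ∈ W ∩ N[ v ] → 7 * 2 ^ k * misIn (W ─ N[ u ]) k ≤ 6 * 7 ^ k
        each-branch u u∈ with lowVertex-after-removal (proj₁ (x∈p∩q⁻ W _ u∈)) ¬low
        ... | w , w∈ , low = ≤-trans (≤-reflexive (*-assoc 7 (2 ^ k) _)) (misIn-bound-low k w∈ low)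

      misIn-bound-low : ∀ k {W v} → v ∈ W → degreeIn W v ≤ 2 → 7 * (2 ^ k * misIn W k) ≤ 6 * 7 ^ k
      misIn-bound-low zero v∈W _ rewrite misIn-0≡0 v∈W = z≤n
      misIn-bound-low (suc k) = low-vertex-step k (misIn-bound k)

    mis-bound : ∀ k → 2 ^ k * mis G k ≤ 7 ^ k
    mis-bound k = ≤-trans (*-monoʳ-≤ (2 ^ k) (mis≤misIn-⊤ k)) (misIn-bound k _)

module Numerics where

  open import Data.Nat using (ℕ; zero; suc; _+_; _*_; _∸_; _^_; _≤_; NonZero)
  open import Data.Nat.Properties
  open import Data.Nat.Tactic.RingSolver using (solve-∀)
  open import Data.Integer as ℤ using (+_; +≤+)
  open import Data.Integer.Properties using (pos-*; drop‿+≤+)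
  open import Data.Rational using (ℚ; _/_; toℚᵘ)
  import Data.Rational as ℚ
  open import Data.Rational.Properties using (toℚᵘ-homo-*; toℚᵘ-fromℚᵘ; toℚᵘ-mono-≤; toℚᵘ-cancel-≤)
  open import Data.Rational.Unnormalised as ℚᵘ using (ℚᵘ; mkℚᵘ; ↥_; ↧ₙ_; *≤*; _≃_; 1ℚᵘ)
  open import Data.Rational.Unnormalised.Properties
    using (≃-refl; ≃-sym; ≃-trans; *-cong; *-congˡ; ≤-respˡ-≃; ≤-respʳ-≃)
  open import Data.Unit using (tt)
  open import Relation.Binary.PropositionalEquality
  open import Algebra.Properties.CommutativeSemigroup *-commutativeSemigroup using (xy∙z≈xz∙y)

  open import Defs using (_^ℚ_)

  ^-distribʳ-* : ∀ m n o → (m * n) ^ o ≡ m ^ o * n ^ o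
  ^-distribʳ-* m n zero = refl
  ^-distribʳ-* m n (suc o) = trans (cong (m * n *_) (^-distribʳ-* m n o)) ([m*n]*[o*p]≡[m*o]*[n*p] m n (m ^ o) (n ^ o))

  [m^a]^b≡[m^b]^a : ∀ m a b → (m ^ a) ^ b ≡ (m ^ b) ^ a
  [m^a]^b≡[m^b]^a m a b = trans (^-*-assoc m a b) (trans (cong (m ^_) (*-comm a b)) (sym (^-*-assoc m b a)))

  ^-cancelˡ-≤ : ∀ k .{{_ : NonZero k}} {m n} → m ^ k ≤ n ^ k → m ≤ n
  ^-cancelˡ-≤ k mᵏ≤nᵏ = ≮⇒≥ λ n<m → <⇒≱ (^-monoˡ-< k n<m) mᵏ≤nᵏ

  -- (7/2)^(21/20) ≤ 15/4, raised to the 20th power.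
  7²¹4²⁰≤15²⁰2²¹ : 7 ^ 21 * 4 ^ 20 ≤ 15 ^ 20 * 2 ^ 21
  7²¹4²⁰≤15²⁰2²¹ = ≤ᵇ⇒≤ _ _ tt

  eightieth-power-bound : ∀ k m n → 2 ^ k * m ≤ 7 ^ k → 80 * k ≤ 21 * n → m ^ 80 * 2 ^ (21 * n) ≤ 7 ^ (21 * n)
  eightieth-power-bound k m n 2ᵏm≤7ᵏ 80k≤21n = begin
    m ^ 80 * 2 ^ (21 * n)              ≡⟨ cong (λ e → m ^ 80 * 2 ^ e) 21n≡80k+j ⟩
    m ^ 80 * 2 ^ (80 * k + j)          ≡⟨ cong (m ^ 80 *_) (^-distribˡ-+-* 2 (80 * k) j) ⟩
    m ^ 80 * (2 ^ (80 * k) * 2 ^ j)    ≡⟨ sym (*-assoc (m ^ 80) _ _) ⟩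
    m ^ 80 * 2 ^ (80 * k) * 2 ^ j      ≡⟨ cong (λ x → m ^ 80 * x * 2 ^ j) (2^[80k]≡[2ᵏ]⁸⁰) ⟩
    m ^ 80 * (2 ^ k) ^ 80 * 2 ^ j      ≡⟨ cong (_* 2 ^ j) (trans (*-comm (m ^ 80) _) (sym (^-distribʳ-* (2 ^ k) m 80))) ⟩
    (2 ^ k * m) ^ 80 * 2 ^ j           ≤⟨ *-mono-≤ (^-monoˡ-≤ 80 2ᵏm≤7ᵏ) (^-monoˡ-≤ j {2} {7} (≤ᵇ⇒≤ 2 7 tt)) ⟩
    (7 ^ k) ^ 80 * 7 ^ j               ≡⟨ cong (_* 7 ^ j) (^-*-assoc 7 k 80) ⟩
    7 ^ (k * 80) * 7 ^ j               ≡⟨ sym (^-distribˡ-+-* 7 (k * 80) j) ⟩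
    7 ^ (k * 80 + j)                   ≡⟨ cong (λ e → 7 ^ (e + j)) (*-comm k 80) ⟩
    7 ^ (80 * k + j)                   ≡⟨ cong (7 ^_) (sym 21n≡80k+j) ⟩
    7 ^ (21 * n)                       ∎
    where
    open ≤-Reasoning
    j = 21 * n ∸ 80 * k
    21n≡80k+j : 21 * n ≡ 80 * k + j
    21n≡80k+j = sym (m+[n∸m]≡n 80k≤21n)
    2^[80k]≡[2ᵏ]⁸⁰ : 2 ^ (80 * k) ≡ (2 ^ k) ^ 80
    2^[80k]≡[2ᵏ]⁸⁰ = trans (cong (2 ^_) (*-comm 80 k)) (sym (^-*-assoc 2 k 80))

  growth-bound : ∀ k m n → 2 ^ k * m ≤ 7 ^ k → 80 * k ≤ 21 * n → m ^ 4 * 4 ^ n ≤ 15 ^ n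
  growth-bound k m n 2ᵏm≤7ᵏ 80k≤21n =
    ^-cancelˡ-≤ 20 (*-cancelʳ-≤ _ _ (2 ^ (21 * n)) {{m^n≢0 2 (21 * n)}} (begin
      (m ^ 4 * 4 ^ n) ^ 20 * 2 ^ (21 * n)         ≡⟨ cong (_* 2 ^ (21 * n)) (^-distribʳ-* (m ^ 4) (4 ^ n) 20) ⟩
      (m ^ 4) ^ 20 * (4 ^ n) ^ 20 * 2 ^ (21 * n)  ≡⟨ xy∙z≈xz∙y ((m ^ 4) ^ 20) _ _ ⟩
      (m ^ 4) ^ 20 * 2 ^ (21 * n) * (4 ^ n) ^ 20
        ≡⟨ cong₂ (λ x y → x * 2 ^ (21 * n) * y) (^-*-assoc m 4 20) ([m^a]^b≡[m^b]^a 4 n 20) ⟩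
      m ^ 80 * 2 ^ (21 * n) * (4 ^ 20) ^ n
        ≤⟨ *-monoˡ-≤ ((4 ^ 20) ^ n) (eightieth-power-bound k m n 2ᵏm≤7ᵏ 80k≤21n) ⟩
      7 ^ (21 * n) * (4 ^ 20) ^ n                 ≡⟨ cong (_* (4 ^ 20) ^ n) (sym (^-*-assoc 7 21 n)) ⟩
      (7 ^ 21) ^ n * (4 ^ 20) ^ n                 ≡⟨ sym (^-distribʳ-* (7 ^ 21) (4 ^ 20) n) ⟩
      (7 ^ 21 * 4 ^ 20) ^ n                       ≤⟨ ^-monoˡ-≤ n 7²¹4²⁰≤15²⁰2²¹ ⟩
      (15 ^ 20 * 2 ^ 21) ^ n                      ≡⟨ ^-distribʳ-* (15 ^ 20) (2 ^ 21) n ⟩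
      (15 ^ 20) ^ n * (2 ^ 21) ^ n                ≡⟨ cong₂ _*_ ([m^a]^b≡[m^b]^a 15 20 n) (^-*-assoc 2 21 n) ⟩
      (15 ^ n) ^ 20 * 2 ^ (21 * n)                ∎))
    where open ≤-Reasoning

  ε δ : ℚ
  ε = + 1 / 20
  δ = + 1 / 4

  infixr 8 _^ᵘ_
  _^ᵘ_ : ℚᵘ → ℕ → ℚᵘ
  p ^ᵘ zero = 1ℚᵘ
  p ^ᵘ suc m = p ℚᵘ.* p ^ᵘ m

  toℚᵘ-^ℚ : ∀ q m → toℚᵘ (q ^ℚ m) ≃ toℚᵘ q ^ᵘ m
  toℚᵘ-^ℚ q zero = ≃-refl
  toℚᵘ-^ℚ q (suc m) = ≃-trans (toℚᵘ-homo-* q (q ^ℚ m)) (*-congˡ {toℚᵘ q} (toℚᵘ-^ℚ q m))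

  ^ᵘ-congˡ : ∀ m {p q} → p ≃ q → p ^ᵘ m ≃ q ^ᵘ m
  ^ᵘ-congˡ zero p≃q = ≃-refl
  ^ᵘ-congˡ (suc m) p≃q = *-cong p≃q (^ᵘ-congˡ m p≃q)

  ↥-* : ∀ p q → ↥ (p ℚᵘ.* q) ≡ ↥ p ℤ.* ↥ q
  ↥-* (mkℚᵘ _ _) (mkℚᵘ _ _) = refl

  ↧ₙ-* : ∀ p q → ↧ₙ (p ℚᵘ.* q) ≡ ↧ₙ p * ↧ₙ q
  ↧ₙ-* (mkℚᵘ _ _) (mkℚᵘ _ _) = refl

  ↥-^ᵘ : ∀ a b m → ↥ (mkℚᵘ (+ a) b ^ᵘ m) ≡ + (a ^ m)
  ↥-^ᵘ a b zero = refl
  ↥-^ᵘ a b (suc m) = trans (↥-* (mkℚᵘ (+ a) b) (mkℚᵘ (+ a) b ^ᵘ m))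
    (trans (cong (+ a ℤ.*_) (↥-^ᵘ a b m)) (sym (pos-* a (a ^ m))))

  ↧ₙ-^ᵘ : ∀ a b m → ↧ₙ (mkℚᵘ (+ a) b ^ᵘ m) ≡ suc b ^ m
  ↧ₙ-^ᵘ a b zero = refl
  ↧ₙ-^ᵘ a b (suc m) = trans (↧ₙ-* (mkℚᵘ (+ a) b) (mkℚᵘ (+ a) b ^ᵘ m))
    (cong (suc b *_) (↧ₙ-^ᵘ a b m))

  module _ {p q : ℚᵘ} {a b c d : ℕ}
           (↥p≡a : ↥ p ≡ + a) (↧p≡b : ↧ₙ p ≡ b) (↥q≡c : ↥ q ≡ + c) (↧q≡d : ↧ₙ q ≡ d) where

    private
      ↥p↧q≡ad : ↥ p ℤ.* ℚᵘ.↧ q ≡ + (a * d)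
      ↥p↧q≡ad = trans (cong₂ ℤ._*_ ↥p≡a (cong +_ ↧q≡d)) (sym (pos-* a d))
      ↥q↧p≡cb : ↥ q ℤ.* ℚᵘ.↧ p ≡ + (c * b)
      ↥q↧p≡cb = trans (cong₂ ℤ._*_ ↥q≡c (cong +_ ↧p≡b)) (sym (pos-* c b))

    cross-multiply⁻ : p ℚᵘ.≤ q → a * d ≤ c * b
    cross-multiply⁻ (*≤* p≤q) = drop‿+≤+ (subst₂ ℤ._≤_ ↥p↧q≡ad ↥q↧p≡cb p≤q)

    cross-multiply⁺ : a * d ≤ c * b → p ℚᵘ.≤ q
    cross-multiply⁺ ad≤cb = *≤* (subst₂ ℤ._≤_ (sym ↥p↧q≡ad) (sym ↥q↧p≡cb) (+≤+ ad≤cb))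

  -- mkℚᵘ a b stands for a / (b + 1): 1 + ε is mkℚᵘ (+ 21) 19 and 4 - δ is mkℚᵘ (+ 15) 3.
  80k≤21n-from-ℚ : ∀ k n → (+ 4 / 1) ℚ.* (+ k / 1) ℚ.≤ (ℚ.1ℚ ℚ.+ ε) ℚ.* (+ n / 1) → 80 * k ≤ 21 * n
  80k≤21n-from-ℚ k n 4k≤[1+ε]n = begin
    80 * k       ≡⟨ regroup k ⟩
    4 * k * 20   ≤⟨ cross-multiply⁻ (sym (pos-* 4 k)) refl (sym (pos-* 21 n)) refl in-ℚᵘ ⟩
    21 * n * 1   ≡⟨ *-identityʳ (21 * n) ⟩
    21 * n       ∎
    where
    open ≤-Reasoning
    regroup : ∀ k → 80 * k ≡ 4 * k * 20
    regroup = solve-∀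
    in-ℚᵘ : mkℚᵘ (+ 4) 0 ℚᵘ.* mkℚᵘ (+ k) 0 ℚᵘ.≤ mkℚᵘ (+ 21) 19 ℚᵘ.* mkℚᵘ (+ n) 0
    in-ℚᵘ = ≤-respʳ-≃ rhs (≤-respˡ-≃ lhs (toℚᵘ-mono-≤ 4k≤[1+ε]n))
      where
      lhs : toℚᵘ ((+ 4 / 1) ℚ.* (+ k / 1)) ≃ mkℚᵘ (+ 4) 0 ℚᵘ.* mkℚᵘ (+ k) 0
      lhs = ≃-trans (toℚᵘ-homo-* (+ 4 / 1) (+ k / 1))
        (*-cong (toℚᵘ-fromℚᵘ (mkℚᵘ (+ 4) 0)) (toℚᵘ-fromℚᵘ (mkℚᵘ (+ k) 0)))
      rhs : toℚᵘ ((ℚ.1ℚ ℚ.+ ε) ℚ.* (+ n / 1)) ≃ mkℚᵘ (+ 21) 19 ℚᵘ.* mkℚᵘ (+ n) 0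
      rhs = ≃-trans (toℚᵘ-homo-* (ℚ.1ℚ ℚ.+ ε) (+ n / 1))
        (*-cong (toℚᵘ-fromℚᵘ (mkℚᵘ (+ 21) 19)) (toℚᵘ-fromℚᵘ (mkℚᵘ (+ n) 0)))

  fourth-power-bound-in-ℚ : ∀ m n → m ^ 4 * 4 ^ n ≤ 15 ^ n → (+ m / 1) ^ℚ 4 ℚ.≤ (+ 4 / 1 ℚ.- δ) ^ℚ n
  fourth-power-bound-in-ℚ m n m⁴4ⁿ≤15ⁿ = toℚᵘ-cancel-≤ (≤-respʳ-≃ (≃-sym rhs) (≤-respˡ-≃ (≃-sym lhs)
    (cross-multiply⁺ (↥-^ᵘ m 0 4) (↧ₙ-^ᵘ m 0 4) (↥-^ᵘ 15 3 n) (↧ₙ-^ᵘ 15 3 n)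
      (subst (m ^ 4 * 4 ^ n ≤_) (sym (*-identityʳ (15 ^ n))) m⁴4ⁿ≤15ⁿ))))
    where
    lhs : toℚᵘ ((+ m / 1) ^ℚ 4) ≃ mkℚᵘ (+ m) 0 ^ᵘ 4
    lhs = ≃-trans (toℚᵘ-^ℚ (+ m / 1) 4) (^ᵘ-congˡ 4 (toℚᵘ-fromℚᵘ (mkℚᵘ (+ m) 0)))
    rhs : toℚᵘ ((+ 4 / 1 ℚ.- δ) ^ℚ n) ≃ mkℚᵘ (+ 15) 3 ^ᵘ n
    rhs = ≃-trans (toℚᵘ-^ℚ (+ 4 / 1 ℚ.- δ) n) (^ᵘ-congˡ n (toℚᵘ-fromℚᵘ (mkℚᵘ (+ 15) 3)))

open import Defs
open import Data.Nat using (ℕ; zero; suc)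
open import Data.Integer using (+_)
open import Data.Rational using (ℚ; _/_; _+_; _-_; _*_; _≤_; _<_; 0ℚ; 1ℚ)
open import Data.Product using (Σ; _×_)

open import Data.Product using (_,_)
open import Data.Unit using (tt)
open import Relation.Nullary.Decidable using (toWitness)
import Data.Rational.Properties as ℚ
open Graphs.Subcubic using (mis-bound)
open Numerics

theorem2 : Σ ℚ λ ε → Σ ℚ λ δ → (0ℚ < ε) × (0ℚ < δ) × (δ < + 4 / 1) ×
    (∀ (n : ℕ) (G : Graph n) → K4Free G → MaxDegreeAtMost G 3 →
      ∀ (k : ℕ) → 1 Data.Nat.≤ k →
      (+ 4 / 1) * (+ k / 1) ≤ (1ℚ + ε) * (+ n / 1) →
      (+ (mis G k) / 1) ^ℚ 4 ≤ (+ 4 / 1 - δ) ^ℚ n)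
theorem2 = ε , δ
  , toWitness {a? = 0ℚ ℚ.<? ε} tt , toWitness {a? = 0ℚ ℚ.<? δ} tt , toWitness {a? = δ ℚ.<? + 4 / 1} tt
  -- The bound also holds for k = 0.
  , λ n G k4 md k _ 4k≤[1+ε]n →
      fourth-power-bound-in-ℚ (mis G k) n
        (growth-bound k (mis G k) n (mis-bound G k4 md k) (80k≤21n-from-ℚ k n 4k≤[1+ε]n))
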